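{- Let $T$ be the succinct $(n,h)$-universal tree. Then there exists a cover $\mathcal{C}$ of $\mathcal{T}$ such that $|\mathcal{C}_j|=1$ for all $0\le j\le h$; equivalently, each $(\mathcal{T}_j,\sqsubseteq)$ is a chain.
   Context: Ordered trees: prefix-closed sets of tuples over a linearly ordered set, viewed as rooted trees (root = empty tuple), ordered lexicographically, all leaves of a height-$h$ tree at depth $h$. $T\sqsubseteq T'$ if there is an injective map $V(T)\to V(T')$ mapping edges to edges, preserving order, and mapping leaves to leaves; $T\equiv T'$ if both $T\sqsubseteq T'$ and $T'\sqsubseteq T$. The succinct $(n,h)$-universal tree: strings are finite binary strings, linearly ordered by $0s<\varepsilon<1s'$ and $bs<bs'\iff s<s'$ for strings $s,s'$, bit $b$, empty string $\varepsilon$. Its leaves are all $h$-tuples $(\xi_{2h-1},\xi_{2h-3},\dots,\xi_1)$ of binary strings whose total number of bits is at most $\lfloor\log_2 n\rfloor$, and the tree consists of all prefixes of these tuples. For $0\le j\le h$, $\mathcal{T}_j$ is the set of pairwise non-equivalent (w.r.t. $\equiv$) subtrees of $T$ rooted at vertices of depth $h-j$, and $\mathcal{T}=\bigcup_j\mathcal{T}_j$. A cover of $\mathcal{T}$ is a tuple $\mathcal{C}=(\mathcal{C}_0,\dots,\mathcal{C}_h)$ where each $\mathcal{C}_j$ is a tuple of chains of the poset $(\mathcal{T}_j,\sqsubseteq)$ whose union is $\mathcal{T}_j$. -}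

module Defs where

open import Data.Bool using (Bool; true; false)
open import Data.Nat using (ℕ; _≤_; _∸_)
open import Data.Nat.Logarithm using (⌊log₂_⌋)
open import Data.List using (List; []; _∷_; _++_; [_]; length; map)
open import Data.Nat.ListAction using (sum)
open import Data.Product using (Σ; ∃; _×_; proj₁)
open import Relation.Binary.PropositionalEquality using (_≡_)
open import Relation.Nullary using (¬_)

-- Binary strings: bit 0 = false, bit 1 = true.
BinStr : Set
BinStr = List Bool

data _<S_ : BinStr → BinStr → Set where
  0<ε  : ∀ {s} → (false ∷ s) <S []
  ε<1  : ∀ {s} → [] <S (true ∷ s)
  0<1  : ∀ {s s'} → (false ∷ s) <S (true ∷ s')
  b<b  : ∀ {b s s'} → s <S s' → (b ∷ s) <S (b ∷ s')

Tuple : Set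
Tuple = List BinStr

data _<L_ : Tuple → Tuple → Set where
  []<  : ∀ {x xs} → [] <L (x ∷ xs)
  hd<  : ∀ {x y xs ys} → x <S y → (x ∷ xs) <L (y ∷ ys)
  tl<  : ∀ {x xs ys} → xs <L ys → (x ∷ xs) <L (x ∷ ys)

-- A tree is given by its (prefix-closed) set of vertices.
Tree : Set₁
Tree = Tuple → Set

Child : Tuple → Tuple → Set
Child s t = ∃ λ x → t ≡ s ++ [ x ]

IsLeaf : Tree → Tuple → Set
IsLeaf P s = P s × (∀ x → ¬ P (s ++ [ x ]))

record _⊑_ (P Q : Tree) : Set where
  field
    f      : Σ Tuple P → Σ Tuple Q
    inj    : ∀ a b → proj₁ (f a) ≡ proj₁ (f b) → proj₁ a ≡ proj₁ b
    edge   : ∀ a b → Child (proj₁ a) (proj₁ b) → Child (proj₁ (f a)) (proj₁ (f b))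
    order  : ∀ a b → proj₁ a <L proj₁ b → proj₁ (f a) <L proj₁ (f b)
    leaf   : ∀ a → IsLeaf P (proj₁ a) → IsLeaf Q (proj₁ (f a))

UnivLeaf : ℕ → ℕ → Tuple → Set
UnivLeaf n h ℓ = (length ℓ ≡ h) × (sum (map length ℓ) ≤ ⌊log₂ n ⌋)

Univ : ℕ → ℕ → Tree
Univ n h u = ∃ λ ℓ → UnivLeaf n h ℓ × ∃ λ s → u ++ s ≡ ℓ

Subtree : Tree → Tuple → Tree
Subtree T u s = T (u ++ s)

-- Whether u ++ s is a vertex of the succinct universal tree depends on u only
-- through its length and its number of bits, monotonically in the latter.
-- So of two roots u, v of equal depth, the one using fewer bits has a subtree
-- containing the other's as a set of suffixes. The leaves of the universal
-- tree are exactly its vertices of depth h, so this inclusion maps leaves to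
-- leaves, and the identity on suffixes is an embedding.
module Submission where

open import Defs
open import Data.Nat using (ℕ; _≤_; _∸_)
open import Data.List using (length)
open import Data.Sum using (_⊎_)
open import Relation.Binary.PropositionalEquality using (_≡_)

open import Data.Nat using (_+_)
open import Data.Nat.Properties using (≤-trans; ≤-reflexive; ≤-total; m≤m+n; +-monoˡ-≤; +-comm; 1+n≰n)
open import Data.List using ([]; _∷_; _++_; [_]; map)
open import Data.List.Properties using (length-++; map-++; ++-assoc; ++-identityʳ)
open import Data.Nat.ListAction using (sum)
open import Data.Nat.ListAction.Properties using (sum-++)
open import Data.Product using (_,_; proj₁)
import Data.Sum as Sum
open import Function.Base using (_∘_)
open import Function.Bundles using (_⇔_; mk⇔; Equivalence)
open Equivalence using (to; from)
open import Relation.Binary.PropositionalEquality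
  using (refl; sym; trans; cong; subst; module ≡-Reasoning)

bits : Tuple → ℕ
bits xs = sum (map length xs)

bits-++ : ∀ xs ys → bits (xs ++ ys) ≡ bits xs + bits ys
bits-++ xs ys = trans (cong sum (map-++ length xs ys)) (sum-++ (map length xs) (map length ys))

⊆∧leaves⇒⊑ : {P Q : Tree} → (∀ {s} → P s → Q s) → (∀ {s} → IsLeaf P s → IsLeaf Q s) → P ⊑ Q
⊆∧leaves⇒⊑ P⊆Q leaves = record
  { f     = λ (s , p) → s , P⊆Q p
  ; inj   = λ _ _ eq → eq
  ; edge  = λ _ _ child → child
  ; order = λ _ _ lt → lt
  ; leaf  = λ _ → leaves
  }

IsLeaf-Subtree : (T : Tree) (u s : Tuple) → IsLeaf (Subtree T u) s ⇔ IsLeaf T (u ++ s)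
IsLeaf-Subtree T u s = mk⇔
  (λ (p , noChild) → p , λ x → noChild x ∘ subst T (++-assoc u s [ x ]))
  (λ (p , noChild) → p , λ x → noChild x ∘ subst T (sym (++-assoc u s [ x ])))

length-replace-prefix : ∀ (u v : Tuple) r → length u ≡ length v → length (v ++ r) ≡ length (u ++ r)
length-replace-prefix u v r |u|≡|v| = begin
  length (v ++ r)       ≡⟨ length-++ v ⟩
  length v + length r   ≡⟨ cong (_+ length r) (sym |u|≡|v|) ⟩
  length u + length r   ≡⟨ sym (length-++ u) ⟩
  length (u ++ r)       ∎
  where open ≡-Reasoning

module _ (n h : ℕ) where

  UnivLeaf-replace-prefix : ∀ u v r → length u ≡ length v → bits v ≤ bits u →
    UnivLeaf n h (u ++ r) → UnivLeaf n h (v ++ r)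
  UnivLeaf-replace-prefix u v r |u|≡|v| bv≤bu (len , budget) = len′ , budget′
    where
    len′ : length (v ++ r) ≡ h
    len′ = trans (length-replace-prefix u v r |u|≡|v|) len
    budget′ : bits (v ++ r) ≤ _
    budget′ = subst (_≤ _) (sym (bits-++ v r))
      (≤-trans (+-monoˡ-≤ (bits r) bv≤bu) (subst (_≤ _) (bits-++ u r) budget))

  Univ-replace-prefix : ∀ u v s → length u ≡ length v → bits v ≤ bits u →
    Univ n h (u ++ s) → Univ n h (v ++ s)
  Univ-replace-prefix u v s |u|≡|v| bv≤bu (ℓ , leaf , t , refl) =
    (v ++ s) ++ t , leaf′ , t , refl
    where
    leaf′ : UnivLeaf n h ((v ++ s) ++ t)
    leaf′ = subst (UnivLeaf n h) (sym (++-assoc v s t))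
      (UnivLeaf-replace-prefix u v (s ++ t) |u|≡|v| bv≤bu
        (subst (UnivLeaf n h) (++-assoc u s t) leaf))

  Univ⇒length≤ : ∀ {w} → Univ n h w → length w ≤ h
  Univ⇒length≤ {w} (_ , (len , _) , t , refl) =
    ≤-trans (m≤m+n (length w) (length t)) (≤-reflexive (trans (sym (length-++ w)) len))

  IsLeaf-Univ⇒length≡ : ∀ {w} → IsLeaf (Univ n h) w → length w ≡ h
  IsLeaf-Univ⇒length≡ {w} ((_ , leaf , [] , eq) , _) =
    trans (cong length (trans (sym (++-identityʳ w)) eq)) (proj₁ leaf)
  IsLeaf-Univ⇒length≡ {w} ((ℓ , leaf , y ∷ t , eq) , noChild) with () ←
    noChild y (ℓ , leaf , t , trans (++-assoc w [ y ] t) eq)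

  length≡⇒IsLeaf-Univ : ∀ {w} → Univ n h w → length w ≡ h → IsLeaf (Univ n h) w
  length≡⇒IsLeaf-Univ {w} p refl = p , λ x child →
    1+n≰n (subst (_≤ length w) (trans (length-++ w) (+-comm (length w) 1)) (Univ⇒length≤ child))

  Subtree-Univ-⊑ : ∀ u v → length u ≡ length v → bits v ≤ bits u →
    Subtree (Univ n h) u ⊑ Subtree (Univ n h) v
  Subtree-Univ-⊑ u v |u|≡|v| bv≤bu =
    ⊆∧leaves⇒⊑ (Univ-replace-prefix u v _ |u|≡|v| bv≤bu) leaves
    where
    leaves : ∀ {s} → IsLeaf (Subtree (Univ n h) u) s → IsLeaf (Subtree (Univ n h) v) s
    leaves {s} isLeaf = from (IsLeaf-Subtree (Univ n h) v s)
      (length≡⇒IsLeaf-Univ (Univ-replace-prefix u v s |u|≡|v| bv≤bu (proj₁ uLeaf))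
        (trans (length-replace-prefix u v s |u|≡|v|) (IsLeaf-Univ⇒length≡ uLeaf)))
      where
      uLeaf : IsLeaf (Univ n h) (u ++ s)
      uLeaf = to (IsLeaf-Subtree (Univ n h) u s) isLeaf

lemma4p15 : (n h : ℕ) → 1 ≤ n → (j : ℕ) → j ≤ h →
    (u v : Tuple) → Univ n h u → Univ n h v →
    length u ≡ h ∸ j → length v ≡ h ∸ j →
    (Subtree (Univ n h) u ⊑ Subtree (Univ n h) v) ⊎ (Subtree (Univ n h) v ⊑ Subtree (Univ n h) u)
lemma4p15 n h _ j _ u v _ _ |u|≡h-j |v|≡h-j =
  Sum.map (Subtree-Univ-⊑ n h u v |u|≡|v|) (Subtree-Univ-⊑ n h v u (sym |u|≡|v|))
    (≤-total (bits v) (bits u))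
  where
  |u|≡|v| : length u ≡ length v
  |u|≡|v| = trans |u|≡h-j (sym |v|≡h-j)
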